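{- Let $5\leq r\leq n$ be integers with $r$ odd, and let $h:\mathbb{Z}^+\to\mathbb{R}$. If $h$ is strictly increasing, then $F_h(3,n)>F_h(r,n)$. If $h$ is strictly decreasing, then $F_h(3,n)<F_h(r,n)$. Here, for odd $r$ with $3\le r\le n$, \[ F_h(r,n)=\sum_{j=1}^{\frac{r-1}{2}}r\,h(j)+\sum_{j=1}^{n-r}(n-r+1-j)\,h(j)+2\sum_{k=1}^{n-r}\sum_{j=1}^{\frac{r-1}{2}}h(k+j). \]
   Context: Empty sums (upper limit smaller than lower limit) are $0$. In particular $F_h(3,n)=n\,h(1)+\sum_{j=2}^{n-2}(n-j)h(j)$. -}

module Defs where

open import Level using (Level; suc; _⊔_)
open import Data.Nat using (ℕ; zero; _+_; _∸_; _/_; _≤_)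
import Data.Nat as ℕ
open import Algebra.Bundles using (AbelianGroup)
open import Relation.Binary.Core using (Rel)
open import Relation.Binary.Structures using (IsStrictTotalOrder)

-- The real numbers (ℝ, +, <) are the intended instance; ℝ is not available
-- in agda-stdlib, so the statement is made for every ordered abelian group.
record OrderedAbelianGroup (c ℓ₁ ℓ₂ : Level) : Set (Level.suc (c ⊔ ℓ₁ ⊔ ℓ₂)) where
  field
    abelianGroup : AbelianGroup c ℓ₁
  open AbelianGroup abelianGroup public
  field
    _<_                : Rel Carrier ℓ₂
    isStrictTotalOrder : IsStrictTotalOrder _≈_ _<_
    ∙-monoˡ-<          : ∀ {x y} z → x < y → (x ∙ z) < (y ∙ z)

module _ {c ℓ₁ ℓ₂ : Level} (G : OrderedAbelianGroup c ℓ₁ ℓ₂) where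
  open OrderedAbelianGroup G
  open import Algebra.Definitions.RawMonoid rawMonoid using (_×_)

  sum1 : ℕ → (ℕ → Carrier) → Carrier
  sum1 zero    f = ε
  sum1 (ℕ.suc m) f = sum1 m f ∙ f (ℕ.suc m)

  StrictlyIncreasing : (ℕ → Carrier) → Set ℓ₂
  StrictlyIncreasing h = ∀ {i j} → 1 ≤ i → i ℕ.< j → h i < h j

  StrictlyDecreasing : (ℕ → Carrier) → Set ℓ₂
  StrictlyDecreasing h = ∀ {i j} → 1 ≤ i → i ℕ.< j → h j < h i

  F : (ℕ → Carrier) → ℕ → ℕ → Carrier
  F h r n =
      sum1 ((r ∸ 1) / 2) (λ j → r × h j)
    ∙ sum1 (n ∸ r) (λ j → (n ∸ r + 1 ∸ j) × h j)
    ∙ 2 × sum1 (n ∸ r) (λ k → sum1 ((r ∸ 1) / 2) (λ j → h (k + j)))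

-- With r = 2s+1 and n = r + m, F_h(r,n) satisfies two recurrences: raising m by one
-- adds Δₘ = ∑_{j≤m+1} h(j) + 2∑_{j≤s} h(m+1+j), and at m = 0 raising s by one adds
-- Δₛ = 2∑_{j≤s} h(j) + (2s+3)h(s+1).  Both F_h(r,n) and F_h(3,n) are then built from
-- F_h(r,r) and F_h(3,r) by the same number of m-steps, and each increment for r is
-- beaten by the corresponding one for 3, because for increasing h the terms of the
-- former are dominated termwise by terms of the latter with larger indices; the base
-- comparison F_h(r,r) < F_h(3,r) follows in the same way by induction on s, two
-- m-steps for 3 against one s-step for r.  Decreasing h is the same statement for the
-- reversed order.
module Submission where

open import Defs
open import Level using (Level)
open import Data.Nat using (ℕ; _≤_; _%_)
open import Data.Product using (_×_)
open import Relation.Binary.PropositionalEquality using (_≡_)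

open import Data.Nat using (zero; suc; _+_; _*_; _∸_; _/_; z≤n; s≤s)
import Data.Nat.Properties as ℕ
open import Data.Nat.DivMod using (m≡m%n+[m/n]*n; m*n/n≡m)
open import Data.Nat.Tactic.RingSolver using () renaming (solve to solve-ℕ)
open import Data.List using (_∷_; [])
open import Data.Product using (∃; _,_)
open import Data.Sum using (inj₁; inj₂)
import Relation.Binary.PropositionalEquality as ≡
open import Relation.Binary.Bundles using (StrictPartialOrder)
open import Relation.Binary.Structures using (IsStrictTotalOrder)
import Relation.Binary.Construct.Flip.EqAndOrd as Flip

≤-of-+ : ∀ i k {j} → i + k ≡ j → i ≤ j
≤-of-+ i k ≡.refl = ℕ.m≤m+n i k

odd-≥5 : ∀ {r} → 5 ≤ r → r % 2 ≡ 1 → ∃ λ t → r ≡ suc ((2 + t) * 2)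
odd-≥5 {r} 5≤r r-odd = from-half (r / 2) r≡1+2[r/2] 5≤r
  where
  r≡1+2[r/2] : r ≡ suc ((r / 2) * 2)
  r≡1+2[r/2] = ≡.trans (m≡m%n+[m/n]*n r 2) (≡.cong (_+ (r / 2) * 2) r-odd)
  from-half : ∀ k → r ≡ suc (k * 2) → 5 ≤ r → ∃ λ t → r ≡ suc ((2 + t) * 2)
  from-half 0             ≡.refl (s≤s ())
  from-half 1             ≡.refl (s≤s (s≤s (s≤s ())))
  from-half (suc (suc t)) r≡    _ = t , r≡

module OrderedAbelianGroupProperties {c ℓ₁ ℓ₂ : Level} (G : OrderedAbelianGroup c ℓ₁ ℓ₂) where
  open OrderedAbelianGroup G renaming (_<_ to infix 4 _<_)
  open import Algebra.Definitions.RawMonoid rawMonoid using () renaming (_×_ to _⊗_)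

  strictPartialOrder : StrictPartialOrder c ℓ₁ ℓ₂
  strictPartialOrder = record
    { isStrictPartialOrder = IsStrictTotalOrder.isStrictPartialOrder isStrictTotalOrder }

  open import Relation.Binary.Construct.StrictToNonStrict _≈_ _<_ public
    using () renaming (_≤_ to _≤ᵍ_)
  open import Relation.Binary.Reasoning.StrictPartialOrder strictPartialOrder public

  ∙-monoʳ-< : ∀ {y z} x → y < z → x ∙ y < x ∙ z
  ∙-monoʳ-< {y} {z} x y<z = begin-strict
    x ∙ y  ≈⟨ comm x y ⟩
    y ∙ x  <⟨ ∙-monoˡ-< x y<z ⟩
    z ∙ x  ≈⟨ comm z x ⟩
    x ∙ z  ∎

  ∙-monoˡ-≤ : ∀ {x y} z → x ≤ᵍ y → x ∙ z ≤ᵍ y ∙ z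
  ∙-monoˡ-≤ z (inj₁ x<y) = inj₁ (∙-monoˡ-< z x<y)
  ∙-monoˡ-≤ z (inj₂ x≈y) = inj₂ (∙-congʳ x≈y)

  ∙-monoʳ-≤ : ∀ {y z} x → y ≤ᵍ z → x ∙ y ≤ᵍ x ∙ z
  ∙-monoʳ-≤ x (inj₁ y<z) = inj₁ (∙-monoʳ-< x y<z)
  ∙-monoʳ-≤ x (inj₂ y≈z) = inj₂ (∙-congˡ y≈z)

  ∙-mono-≤ : ∀ {a b c d} → a ≤ᵍ b → c ≤ᵍ d → a ∙ c ≤ᵍ b ∙ d
  ∙-mono-≤ {a} {b} {c} {d} a≤b c≤d = begin
    a ∙ c  ≤⟨ ∙-monoʳ-≤ a c≤d ⟩
    a ∙ d  ≤⟨ ∙-monoˡ-≤ d a≤b ⟩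
    b ∙ d  ∎

  ∙-mono-≤-< : ∀ {a b c d} → a ≤ᵍ b → c < d → a ∙ c < b ∙ d
  ∙-mono-≤-< {a} {b} {c} {d} a≤b c<d = begin-strict
    a ∙ c  <⟨ ∙-monoʳ-< a c<d ⟩
    a ∙ d  ≤⟨ ∙-monoˡ-≤ d a≤b ⟩
    b ∙ d  ∎

  ∙-mono-<-≤ : ∀ {a b c d} → a < b → c ≤ᵍ d → a ∙ c < b ∙ d
  ∙-mono-<-≤ {a} {b} {c} {d} a<b c≤d = begin-strict
    a ∙ c  ≤⟨ ∙-monoʳ-≤ a c≤d ⟩
    a ∙ d  <⟨ ∙-monoˡ-< d a<b ⟩
    b ∙ d  ∎

  ∙-mono-< : ∀ {a b c d} → a < b → c < d → a ∙ c < b ∙ d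
  ∙-mono-< a<b = ∙-mono-≤-< (inj₁ a<b)

  ×-monoʳ-≤ : ∀ n {a b} → a ≤ᵍ b → n ⊗ a ≤ᵍ n ⊗ b
  ×-monoʳ-≤ zero    a≤b = inj₂ refl
  ×-monoʳ-≤ (suc n) a≤b = ∙-mono-≤ a≤b (×-monoʳ-≤ n a≤b)

  ×-monoʳ-< : ∀ n {a b} → a < b → suc n ⊗ a < suc n ⊗ b
  ×-monoʳ-< n a<b = ∙-mono-<-≤ a<b (×-monoʳ-≤ n (inj₁ a<b))

module Sum1Properties {c ℓ₁ ℓ₂ : Level} (G : OrderedAbelianGroup c ℓ₁ ℓ₂) where
  open OrderedAbelianGroup G
  open OrderedAbelianGroupProperties G
  open import Algebra.Definitions.RawMonoid rawMonoid using () renaming (_×_ to _⊗_)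
  open import Algebra.Properties.Monoid.Mult monoid using (×-homo-1)
  open import Algebra.Properties.CommutativeMonoid.Mult commutativeMonoid using (×-distrib-+)
  open import Algebra.Solver.CommutativeMonoid commutativeMonoid using (solve; _⊜_; _⊕_)

  ∑ : ℕ → (ℕ → Carrier) → Carrier
  ∑ = sum1 G

  ∑-cong : ∀ m {f g : ℕ → Carrier} → (∀ {j} → 1 ≤ j → j ≤ m → f j ≈ g j) → ∑ m f ≈ ∑ m g
  ∑-cong zero    f≈g = refl
  ∑-cong (suc m) f≈g =
    ∙-cong (∑-cong m (λ 1≤j j≤m → f≈g 1≤j (ℕ.m≤n⇒m≤1+n j≤m))) (f≈g (s≤s z≤n) ℕ.≤-refl)

  ∑-mono-≤ : ∀ m {f g : ℕ → Carrier} → (∀ {j} → 1 ≤ j → j ≤ m → f j ≤ᵍ g j) → ∑ m f ≤ᵍ ∑ m g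
  ∑-mono-≤ zero    f≤g = inj₂ refl
  ∑-mono-≤ (suc m) f≤g =
    ∙-mono-≤ (∑-mono-≤ m (λ 1≤j j≤m → f≤g 1≤j (ℕ.m≤n⇒m≤1+n j≤m))) (f≤g (s≤s z≤n) ℕ.≤-refl)

  ∑-∙ : ∀ m (f g : ℕ → Carrier) → ∑ m (λ j → f j ∙ g j) ≈ ∑ m f ∙ ∑ m g
  ∑-∙ zero    f g = sym (identityˡ ε)
  ∑-∙ (suc m) f g = begin-equality
    ∑ m (λ j → f j ∙ g j) ∙ (f (suc m) ∙ g (suc m))  ≈⟨ ∙-congʳ (∑-∙ m f g) ⟩
    (∑ m f ∙ ∑ m g) ∙ (f (suc m) ∙ g (suc m))
      ≈⟨ solve 4 (λ a b x y → (a ⊕ b) ⊕ (x ⊕ y) ⊜ (a ⊕ x) ⊕ (b ⊕ y)) refl (∑ m f) (∑ m g) (f (suc m)) (g (suc m)) ⟩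
    (∑ m f ∙ f (suc m)) ∙ (∑ m g ∙ g (suc m))        ∎

  ×-∑ : ∀ k m (f : ℕ → Carrier) → k ⊗ ∑ m f ≈ ∑ m (λ j → k ⊗ f j)
  ×-∑ zero    zero    f = refl
  ×-∑ (suc k) zero    f = trans (identityˡ _) (×-∑ k zero f)
  ×-∑ k       (suc m) f = trans (×-distrib-+ (∑ m f) (f (suc m)) k) (∙-congʳ (×-∑ k m f))

  ∑-+ : ∀ a b (f : ℕ → Carrier) → ∑ (a + b) f ≈ ∑ a f ∙ ∑ b (λ j → f (a + j))
  ∑-+ a zero    f rewrite ℕ.+-identityʳ a = sym (identityʳ _)
  ∑-+ a (suc b) f rewrite ℕ.+-suc a b     = trans (∙-congʳ (∑-+ a b f)) (assoc _ _ _)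

  ∑-const : ∀ m x → ∑ m (λ _ → x) ≈ m ⊗ x
  ∑-const zero    x = refl
  ∑-const (suc m) x = trans (∙-congʳ (∑-const m x)) (comm _ _)

  -- ∑_{j≤m} (m+1-j) f(j) is the iterated sum ∑_{k≤m} ∑_{j≤k} f(j).
  ∑-triangle-suc : ∀ m (f : ℕ → Carrier) →
    ∑ (suc m) (λ j → (suc m + 1 ∸ j) ⊗ f j) ≈ ∑ m (λ j → (m + 1 ∸ j) ⊗ f j) ∙ ∑ (suc m) f
  ∑-triangle-suc m f = begin-equality
    ∑ m (λ j → (suc m + 1 ∸ j) ⊗ f j) ∙ (suc m + 1 ∸ suc m) ⊗ f (suc m)
      ≈⟨ ∙-cong (∑-cong m coefficient) last ⟩
    ∑ m (λ j → f j ∙ (m + 1 ∸ j) ⊗ f j) ∙ f (suc m)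
      ≈⟨ ∙-congʳ (∑-∙ m f _) ⟩
    (∑ m f ∙ T) ∙ f (suc m)
      ≈⟨ ∙-congʳ (comm _ _) ⟩
    (T ∙ ∑ m f) ∙ f (suc m)
      ≈⟨ assoc _ _ _ ⟩
    T ∙ ∑ (suc m) f
      ∎
    where
    T = ∑ m (λ j → (m + 1 ∸ j) ⊗ f j)
    coefficient : ∀ {j} → 1 ≤ j → j ≤ m → (suc m + 1 ∸ j) ⊗ f j ≈ f j ∙ (m + 1 ∸ j) ⊗ f j
    coefficient {j} _ j≤m =
      reflexive (≡.cong (_⊗ f j) (ℕ.+-∸-assoc 1 (ℕ.≤-trans j≤m (ℕ.m≤m+n m 1))))
    last : (suc m + 1 ∸ suc m) ⊗ f (suc m) ≈ f (suc m)
    last = trans (reflexive (≡.cong (_⊗ f (suc m)) (ℕ.m+n∸m≡n m 1))) (×-homo-1 _)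

reverseOrder : ∀ {c ℓ₁ ℓ₂} → OrderedAbelianGroup c ℓ₁ ℓ₂ → OrderedAbelianGroup c ℓ₁ ℓ₂
reverseOrder G = record
  { abelianGroup       = abelianGroup
  ; _<_                = λ x y → y < x
  ; isStrictTotalOrder = Flip.isStrictTotalOrder isStrictTotalOrder
  ; ∙-monoˡ-<          = ∙-monoˡ-<
  }
  where open OrderedAbelianGroup G

module _ {c ℓ₁ ℓ₂ : Level} (G : OrderedAbelianGroup c ℓ₁ ℓ₂) where
  open OrderedAbelianGroup G
  open import Algebra.Definitions.RawMonoid rawMonoid using () renaming (_×_ to _⊗_)

  -- sum1 depends on the whole record, so it does not compute to the same term for both orders.
  sum1-reverseOrder : ∀ m {f g : ℕ → Carrier} → (∀ j → f j ≡ g j) → sum1 (reverseOrder G) m f ≡ sum1 G m g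
  sum1-reverseOrder zero    f≡g = ≡.refl
  sum1-reverseOrder (suc m) f≡g = ≡.cong₂ _∙_ (sum1-reverseOrder m f≡g) (f≡g (suc m))

  F-reverseOrder : ∀ h r n → F (reverseOrder G) h r n ≡ F G h r n
  F-reverseOrder h r n =
    ≡.cong₂ _∙_ (≡.cong₂ _∙_ (sum1-reverseOrder half λ _ → ≡.refl) (sum1-reverseOrder (n ∸ r) λ _ → ≡.refl))
                (≡.cong (2 ⊗_) (sum1-reverseOrder (n ∸ r) λ _ → sum1-reverseOrder half λ _ → ≡.refl))
    where half = (r ∸ 1) / 2

module OddRowComparison {c ℓ₁ ℓ₂ : Level} (G : OrderedAbelianGroup c ℓ₁ ℓ₂)
                        (h : ℕ → OrderedAbelianGroup.Carrier G) where
  open OrderedAbelianGroup G renaming (_<_ to infix 4 _<_)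
  open OrderedAbelianGroupProperties G
  open Sum1Properties G
  open import Algebra.Definitions.RawMonoid rawMonoid using () renaming (_×_ to _⊗_)
  open import Algebra.Properties.Monoid.Mult monoid using (×-homo-+; ×-congʳ; ×-assocˡ)
  open import Algebra.Properties.CommutativeMonoid.Mult commutativeMonoid using (×-distrib-+)
  open import Algebra.Solver.CommutativeMonoid commutativeMonoid using (solve; _⊜_; _⊕_; id)

  F′ : ℕ → ℕ → Carrier
  F′ s m = ∑ s (λ j → suc (s * 2) ⊗ h j)
         ∙ ∑ m (λ j → (m + 1 ∸ j) ⊗ h j)
         ∙ 2 ⊗ ∑ m (λ k → ∑ s (λ j → h (k + j)))

  F≡F′ : ∀ s m → F G h (suc (s * 2)) (suc (s * 2) + m) ≡ F′ s m
  F≡F′ s m rewrite m*n/n≡m s 2 ⦃ _ ⦄ | ℕ.m+n∸m≡n (suc (s * 2)) m = ≡.refl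

  Δₘ : ℕ → ℕ → Carrier
  Δₘ s m = ∑ (suc m) h ∙ 2 ⊗ ∑ s (λ j → h (suc m + j))

  Δₛ : ℕ → Carrier
  Δₛ s = 2 ⊗ ∑ s h ∙ suc (suc s * 2) ⊗ h (suc s)

  F′-sucₘ : ∀ s m → F′ s (suc m) ≈ F′ s m ∙ Δₘ s m
  F′-sucₘ s m = begin-equality
    A ∙ ∑ (suc m) (λ j → (suc m + 1 ∸ j) ⊗ h j) ∙ 2 ⊗ (B ∙ Y)
      ≈⟨ ∙-cong (∙-congˡ (∑-triangle-suc m h)) (×-distrib-+ B Y 2) ⟩
    A ∙ (T ∙ ∑ (suc m) h) ∙ (2 ⊗ B ∙ 2 ⊗ Y)
      ≈⟨ solve 5 (λ a t u b y → (a ⊕ (t ⊕ u)) ⊕ (b ⊕ y) ⊜ ((a ⊕ t) ⊕ b) ⊕ (u ⊕ y))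
               refl A T (∑ (suc m) h) (2 ⊗ B) (2 ⊗ Y) ⟩
    (A ∙ T ∙ 2 ⊗ B) ∙ (∑ (suc m) h ∙ 2 ⊗ Y)
      ∎
    where
    A = ∑ s (λ j → suc (s * 2) ⊗ h j)
    T = ∑ m (λ j → (m + 1 ∸ j) ⊗ h j)
    B = ∑ m (λ k → ∑ s (λ j → h (k + j)))
    Y = ∑ s (λ j → h (suc m + j))

  F′-sucₛ : ∀ s → F′ (suc s) 0 ≈ F′ s 0 ∙ Δₛ s
  F′-sucₛ s = begin-equality
    (∑ s (λ j → (2 + suc (s * 2)) ⊗ h j) ∙ Z) ∙ ε ∙ 2 ⊗ ε
      ≈⟨ ∙-congʳ (∙-congʳ (∙-congʳ split)) ⟩
    ((2 ⊗ ∑ s h ∙ A) ∙ Z) ∙ ε ∙ 2 ⊗ ε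
      ≈⟨ solve 3 (λ d a z → (((d ⊕ a) ⊕ z) ⊕ id) ⊕ (id ⊕ (id ⊕ id)) ⊜ ((a ⊕ id) ⊕ (id ⊕ (id ⊕ id))) ⊕ (d ⊕ z))
               refl (2 ⊗ ∑ s h) A Z ⟩
    (A ∙ ε ∙ 2 ⊗ ε) ∙ (2 ⊗ ∑ s h ∙ Z)
      ∎
    where
    A = ∑ s (λ j → suc (s * 2) ⊗ h j)
    Z = suc (suc s * 2) ⊗ h (suc s)
    split : ∑ s (λ j → (2 + suc (s * 2)) ⊗ h j) ≈ 2 ⊗ ∑ s h ∙ A
    split = begin-equality
      ∑ s (λ j → (2 + suc (s * 2)) ⊗ h j)      ≈⟨ ∑-cong s (λ {j} _ _ → ×-homo-+ (h j) 2 (suc (s * 2))) ⟩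
      ∑ s (λ j → 2 ⊗ h j ∙ suc (s * 2) ⊗ h j)  ≈⟨ ∑-∙ s _ _ ⟩
      ∑ s (λ j → 2 ⊗ h j) ∙ A                  ≈⟨ ∙-congʳ (×-∑ 2 s h) ⟨
      2 ⊗ ∑ s h ∙ A                            ∎

  Δₘ-one : ∀ m → Δₘ 1 m ≈ ∑ (suc m) h ∙ 2 ⊗ h (suc (suc m))
  Δₘ-one m = ∙-congˡ (×-congʳ 2 (trans (identityˡ _) (reflexive (≡.cong h (ℕ.+-comm (suc m) 1)))))

  module _ (h-inc : StrictlyIncreasing G h) where

    h-mono-≤ : ∀ {i j} → 1 ≤ i → i ≤ j → h i ≤ᵍ h j
    h-mono-≤ 1≤i i≤j with ℕ.m≤n⇒m<n∨m≡n i≤j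
    ... | inj₁ i<j    = inj₁ (h-inc 1≤i i<j)
    ... | inj₂ ≡.refl = inj₂ refl

    ∑-shift-≤ : ∀ a d k → ∑ k (λ j → h (a + j)) ≤ᵍ ∑ k (λ j → h (a + (d + j)))
    ∑-shift-≤ a d k = ∑-mono-≤ k λ {j} 1≤j _ →
      h-mono-≤ (ℕ.≤-trans 1≤j (ℕ.m≤n+m j a)) (ℕ.+-monoʳ-≤ a (ℕ.m≤n+m j d))

    Δₘ-< : ∀ t m → Δₘ (2 + t) m < Δₘ 1 (2 + t * 2 + m)
    Δₘ-< t m = begin-strict
      P ∙ 2 ⊗ X                 ≈⟨ solve 2 (λ p x → p ⊕ (x ⊕ (x ⊕ id)) ⊜ p ⊕ (x ⊕ x)) refl P X ⟩
      P ∙ (X ∙ X)               <⟨ ∙-monoʳ-< P (∙-monoʳ-< X X<Y∙2top) ⟩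
      P ∙ (X ∙ (Y ∙ 2 ⊗ top))   ≈⟨ solve 4 (λ p x y z → p ⊕ (x ⊕ (y ⊕ z)) ⊜ (p ⊕ (x ⊕ y)) ⊕ z) refl P X Y (2 ⊗ top) ⟩
      (P ∙ (X ∙ Y)) ∙ 2 ⊗ top   ≈⟨ ∙-congʳ split ⟨
      ∑ (suc M) h ∙ 2 ⊗ top     ≈⟨ Δₘ-one M ⟨
      Δₘ 1 M                    ∎
      where
      M = 2 + t * 2 + m
      p = suc m
      g : ℕ → Carrier
      g j = h (p + j)
      P = ∑ p h
      X = ∑ (2 + t) g
      Y = ∑ t (λ j → g (2 + t + j))
      top = h (suc (suc M))
      index-split : suc (2 + t * 2 + m) ≡ suc m + (2 + t + t)
      index-split = solve-ℕ (t ∷ m ∷ [])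
      index₁ : suc (suc m + suc t) + suc t ≡ suc (suc (2 + t * 2 + m))
      index₁ = solve-ℕ (t ∷ m ∷ [])
      index₂ : suc (suc m + (2 + t)) + t ≡ suc (suc (2 + t * 2 + m))
      index₂ = solve-ℕ (t ∷ m ∷ [])
      split : ∑ (suc M) h ≈ P ∙ (X ∙ Y)
      split = begin-equality
        ∑ (suc M) h                   ≡⟨ ≡.cong (λ k → ∑ k h) index-split ⟩
        ∑ (p + (2 + t + t)) h         ≈⟨ ∑-+ p (2 + t + t) h ⟩
        P ∙ ∑ (2 + t + t) g           ≈⟨ ∙-congˡ (∑-+ (2 + t) t g) ⟩
        P ∙ (X ∙ Y)                   ∎
      X<Y∙2top : X < Y ∙ 2 ⊗ top
      X<Y∙2top = begin-strict
        (∑ t g ∙ g (suc t)) ∙ g (2 + t)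
          <⟨ ∙-mono-< (∙-mono-≤-< (∑-shift-≤ p (2 + t) t) (h-inc (s≤s z≤n) (≤-of-+ _ (suc t) index₁)))
                      (h-inc (s≤s z≤n) (≤-of-+ _ t index₂)) ⟩
        (Y ∙ top) ∙ top
          ≈⟨ solve 2 (λ y z → (y ⊕ z) ⊕ z ⊜ y ⊕ (z ⊕ (z ⊕ id))) refl Y top ⟩
        Y ∙ 2 ⊗ top
          ∎

    Δₛ-< : ∀ s → Δₛ (suc s) < Δₘ 1 (s * 2) ∙ Δₘ 1 (suc (s * 2))
    Δₛ-< s = begin-strict
      2 ⊗ P ∙ (5 + s * 2) ⊗ x₀                       ≈⟨ ∙-congˡ spread ⟩
      2 ⊗ P ∙ (2 ⊗ (s ⊗ x₀) ∙ (3 ⊗ x₀ ∙ 2 ⊗ x₀))     <⟨ ∙-monoʳ-< (2 ⊗ P) compare ⟩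
      2 ⊗ P ∙ (2 ⊗ Q ∙ (3 ⊗ u ∙ 2 ⊗ v))              ≈⟨ collect ⟨
      (W ∙ 2 ⊗ u) ∙ ((W ∙ u) ∙ 2 ⊗ v)                ≈⟨ ∙-cong (Δₘ-one (s * 2)) (Δₘ-one (suc (s * 2))) ⟨
      Δₘ 1 (s * 2) ∙ Δₘ 1 (suc (s * 2))              ∎
      where
      q = suc s
      P = ∑ q h
      Q = ∑ s (λ j → h (q + j))
      W = ∑ (suc (s * 2)) h
      x₀ = h (suc q)
      u = h (suc (suc (s * 2)))
      v = h (suc (suc (suc (s * 2))))
      s≤s*2 : s ≤ s * 2
      s≤s*2 = ℕ.m≤m*n s 2
      spread : (5 + s * 2) ⊗ x₀ ≈ 2 ⊗ (s ⊗ x₀) ∙ (3 ⊗ x₀ ∙ 2 ⊗ x₀)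
      spread = begin-equality
        (5 + s * 2) ⊗ x₀            ≈⟨ ×-homo-+ x₀ 5 (s * 2) ⟩
        5 ⊗ x₀ ∙ (s * 2) ⊗ x₀       ≈⟨ comm _ _ ⟩
        (s * 2) ⊗ x₀ ∙ 5 ⊗ x₀       ≡⟨ ≡.cong (λ k → k ⊗ x₀ ∙ 5 ⊗ x₀) (ℕ.*-comm s 2) ⟩
        (2 * s) ⊗ x₀ ∙ 5 ⊗ x₀       ≈⟨ ∙-cong (×-assocˡ x₀ 2 s) (sym (×-homo-+ x₀ 3 2)) ⟨
        2 ⊗ (s ⊗ x₀) ∙ (3 ⊗ x₀ ∙ 2 ⊗ x₀) ∎
      index-split : suc (s * 2) ≡ suc s + s
      index-split = solve-ℕ (s ∷ [])
      W≈P∙Q : W ≈ P ∙ Q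
      W≈P∙Q = begin-equality
        W            ≡⟨ ≡.cong (λ k → ∑ k h) index-split ⟩
        ∑ (q + s) h  ≈⟨ ∑-+ q s h ⟩
        P ∙ Q        ∎
      collect : (W ∙ 2 ⊗ u) ∙ ((W ∙ u) ∙ 2 ⊗ v) ≈ 2 ⊗ P ∙ (2 ⊗ Q ∙ (3 ⊗ u ∙ 2 ⊗ v))
      collect = begin-equality
        (W ∙ 2 ⊗ u) ∙ ((W ∙ u) ∙ 2 ⊗ v)
          ≈⟨ ∙-cong (∙-congʳ W≈P∙Q) (∙-congʳ (∙-congʳ W≈P∙Q)) ⟩
        ((P ∙ Q) ∙ 2 ⊗ u) ∙ (((P ∙ Q) ∙ u) ∙ 2 ⊗ v)
          ≈⟨ solve 4 (λ p q u v →
                 ((p ⊕ q) ⊕ (u ⊕ (u ⊕ id))) ⊕ (((p ⊕ q) ⊕ u) ⊕ (v ⊕ (v ⊕ id)))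
               ⊜ (p ⊕ (p ⊕ id)) ⊕ ((q ⊕ (q ⊕ id)) ⊕ ((u ⊕ (u ⊕ (u ⊕ id))) ⊕ (v ⊕ (v ⊕ id)))))
               refl P Q u v ⟩
        2 ⊗ P ∙ (2 ⊗ Q ∙ (3 ⊗ u ∙ 2 ⊗ v))
          ∎
      s⊗x₀≤Q : s ⊗ x₀ ≤ᵍ Q
      s⊗x₀≤Q = begin
        s ⊗ x₀            ≈⟨ ∑-const s x₀ ⟨
        ∑ s (λ _ → x₀)    ≤⟨ ∑-mono-≤ s (λ {j} 1≤j _ →
                               h-mono-≤ (s≤s z≤n) (ℕ.≤-trans (ℕ.≤-reflexive (ℕ.+-comm 1 q)) (ℕ.+-monoʳ-≤ q 1≤j))) ⟩
        Q                 ∎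
      compare : 2 ⊗ (s ⊗ x₀) ∙ (3 ⊗ x₀ ∙ 2 ⊗ x₀) < 2 ⊗ Q ∙ (3 ⊗ u ∙ 2 ⊗ v)
      compare = ∙-mono-≤-< (×-monoʳ-≤ 2 s⊗x₀≤Q)
                  (∙-mono-≤-< (×-monoʳ-≤ 3 (h-mono-≤ (s≤s z≤n) (s≤s (s≤s s≤s*2))))
                              (×-monoʳ-< 1 (h-inc (s≤s z≤n) (s≤s (s≤s (s≤s s≤s*2))))))

    F′-zero-≤ : ∀ s → F′ (suc s) 0 ≤ᵍ F′ 1 (s * 2)
    F′-zero-< : ∀ s → F′ (2 + s) 0 < F′ 1 (suc s * 2)

    F′-zero-≤ zero    = inj₂ refl
    F′-zero-≤ (suc s) = inj₁ (F′-zero-< s)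

    F′-zero-< s = begin-strict
      F′ (2 + s) 0                                 ≈⟨ F′-sucₛ (suc s) ⟩
      F′ (suc s) 0 ∙ Δₛ (suc s)                    <⟨ ∙-mono-≤-< (F′-zero-≤ s) (Δₛ-< s) ⟩
      F′ 1 M ∙ (Δₘ 1 M ∙ Δₘ 1 (suc M))             ≈⟨ assoc _ _ _ ⟨
      F′ 1 M ∙ Δₘ 1 M ∙ Δₘ 1 (suc M)               ≈⟨ ∙-congʳ (F′-sucₘ 1 M) ⟨
      F′ 1 (suc M) ∙ Δₘ 1 (suc M)                  ≈⟨ F′-sucₘ 1 (suc M) ⟨
      F′ 1 (2 + M)                                 ∎
      where M = s * 2

    F′-< : ∀ t m → F′ (2 + t) m < F′ 1 (2 + t * 2 + m)
    F′-< t zero = begin-strict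
      F′ (2 + t) 0              <⟨ F′-zero-< t ⟩
      F′ 1 (2 + t * 2)          ≡⟨ ≡.cong (F′ 1) (ℕ.+-identityʳ (2 + t * 2)) ⟨
      F′ 1 (2 + t * 2 + 0)      ∎
    F′-< t (suc m) = begin-strict
      F′ (2 + t) (suc m)              ≈⟨ F′-sucₘ (2 + t) m ⟩
      F′ (2 + t) m ∙ Δₘ (2 + t) m     <⟨ ∙-mono-< (F′-< t m) (Δₘ-< t m) ⟩
      F′ 1 M ∙ Δₘ 1 M                 ≈⟨ F′-sucₘ 1 M ⟨
      F′ 1 (suc M)                    ≡⟨ ≡.cong (F′ 1) (ℕ.+-suc (2 + t * 2) m) ⟨
      F′ 1 (2 + t * 2 + suc m)        ∎
      where M = 2 + t * 2 + m

F-<-F₃ : ∀ {c ℓ₁ ℓ₂} (G : OrderedAbelianGroup c ℓ₁ ℓ₂) (h : ℕ → OrderedAbelianGroup.Carrier G) →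
         StrictlyIncreasing G h → ∀ {r n} → 5 ≤ r → r ≤ n → r % 2 ≡ 1 →
         OrderedAbelianGroup._<_ G (F G h r n) (F G h 3 n)
F-<-F₃ G h h-inc {r} {n} 5≤r r≤n r-odd with odd-≥5 5≤r r-odd
... | t , ≡.refl = ≡.subst (λ n → F G h r n < F G h 3 n) (ℕ.m+[n∸m]≡n r≤n)
                     (≡.subst₂ _<_ (≡.sym (F≡F′ (2 + t) m)) (≡.sym (F≡F′ 1 (2 + t * 2 + m))) (F′-< h-inc t m))
  where
  open OrderedAbelianGroup G using (_<_)
  open OddRowComparison G h
  m = n ∸ r

lemma2p4 : ∀ {c ℓ₁ ℓ₂ : Level} (G : OrderedAbelianGroup c ℓ₁ ℓ₂) →
    let open OrderedAbelianGroup G in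
    ∀ (r n : ℕ) → 5 ≤ r → r ≤ n → r % 2 ≡ 1 → (h : ℕ → Carrier) →
      (StrictlyIncreasing G h → F G h r n < F G h 3 n)
      × (StrictlyDecreasing G h → F G h 3 n < F G h r n)
lemma2p4 G r n 5≤r r≤n r-odd h =
    (λ h-inc → F-<-F₃ G h h-inc 5≤r r≤n r-odd)
  , (λ h-dec → ≡.subst₂ _<_ (F-reverseOrder G h 3 n) (F-reverseOrder G h r n)
                 (F-<-F₃ (reverseOrder G) h h-dec 5≤r r≤n r-odd))
  where open OrderedAbelianGroup G using (_<_)
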